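{- Let $A=\{\mathbf a_1,\dots,\mathbf a_n\}\subset\mathbb Z^d$ be a finite set generating $\mathbb Z^d$ as a lattice, let $Q$ be the semigroup generated by $A$, and let $K=\mathrm{cone}(A)$, assumed pointed with non-empty interior. Let $F,G$ be two faces of $K$ with $G\subset F$. If $G$ is almost saturated, then $F$ is almost saturated. Equivalently, if $F$ is nowhere saturated, then $G$ is nowhere saturated.
   Context: $Q=\{\sum_i\lambda_i\mathbf a_i:\lambda_i\in\mathbb N=\{0,1,\dots\}\}$, $K=\{\sum_i\lambda_i\mathbf a_i:\lambda_i\in\mathbb R_{\ge0}\}$, and the saturation of $Q$ is $Q_{\rm sat}=K\cap\mathbb Z^d$. A point $\mathbf a\in Q$ is a saturation point of $Q$ if $\mathbf a+Q_{\rm sat}\subset Q$; $S$ denotes the set of saturation points. A face $F$ of $K$ is called almost saturated if $F\cap S\neq\emptyset$ (i.e. some point of $F$ is a saturation point of $Q$), and nowhere saturated otherwise.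
   Formalization: The cone K is represented by its rational points, and the faces F and G are only those cut out by rational supporting functionals, with pointedness and non-empty interior stated for rational points. -}

module Defs where

open import Data.Nat using (ℕ; zero; suc)
open import Data.Fin using (Fin; zero; suc)
open import Data.Integer as ℤ using (ℤ; +_)
open import Data.Rational as ℚ using (ℚ; 0ℚ; _/_)
open import Data.Product using (Σ; ∃; _×_)
open import Relation.Binary.PropositionalEquality using (_≡_)

ZVec : ℕ → Set
ZVec d = Fin d → ℤ

QVec : ℕ → Set
QVec d = Fin d → ℚ

sumℤ : {n : ℕ} → (Fin n → ℤ) → ℤ
sumℤ {zero}  f = + 0
sumℤ {suc n} f = f zero ℤ.+ sumℤ (λ i → f (suc i))

sumℚ : {n : ℕ} → (Fin n → ℚ) → ℚ
sumℚ {zero}  f = 0ℚ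
sumℚ {suc n} f = f zero ℚ.+ sumℚ (λ i → f (suc i))

toℚ : {d : ℕ} → ZVec d → QVec d
toℚ x j = x j / 1

Config : ℕ → ℕ → Set
Config n d = Fin n → ZVec d

GeneratesLattice : {n d : ℕ} → Config n d → Set
GeneratesLattice {n} {d} A =
  (x : ZVec d) → ∃ λ (k : Fin n → ℤ) → (j : Fin d) → x j ≡ sumℤ (λ i → k i ℤ.* A i j)

InQ : {n d : ℕ} → Config n d → ZVec d → Set
InQ {n} {d} A x =
  ∃ λ (k : Fin n → ℕ) → (j : Fin d) → x j ≡ sumℤ (λ i → + (k i) ℤ.* A i j)

InK : {n d : ℕ} → Config n d → QVec d → Set
InK {n} {d} A x =
  ∃ λ (l : Fin n → ℚ) → ((i : Fin n) → 0ℚ ℚ.≤ l i) ×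
    ((j : Fin d) → x j ≡ sumℚ (λ i → l i ℚ.* (A i j / 1)))

InQsat : {n d : ℕ} → Config n d → ZVec d → Set
InQsat A x = InK A (toℚ x)

Pointed : {n d : ℕ} → Config n d → Set
Pointed {n} {d} A =
  (x : QVec d) → InK A x → InK A (λ j → ℚ.- x j) → (j : Fin d) → x j ≡ 0ℚ

NonEmptyInterior : {n d : ℕ} → Config n d → Set
NonEmptyInterior {n} {d} A =
  Σ (QVec d) λ x → InK A x × Σ ℚ λ ε → (0ℚ ℚ.< ε) ×
    ((y : QVec d) → ((j : Fin d) → ℚ.∣ y j ∣ ℚ.≤ ε) → InK A (λ j → x j ℚ.+ y j))

dot : {d : ℕ} → QVec d → QVec d → ℚ
dot c x = sumℚ (λ j → c j ℚ.* x j)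

-- c defines a supporting hyperplane of K: c ≥ 0 on K.
-- The face it cuts out is F_c = { x ∈ K : c·x = 0 }.
Supporting : {n d : ℕ} → Config n d → QVec d → Set
Supporting {n} {d} A c = (x : QVec d) → InK A x → 0ℚ ℚ.≤ dot c x

InFace : {n d : ℕ} → Config n d → QVec d → QVec d → Set
InFace A c x = InK A x × dot c x ≡ 0ℚ

FaceSubset : {n d : ℕ} → Config n d → QVec d → QVec d → Set
FaceSubset {n} {d} A cG cF = (x : QVec d) → InFace A cG x → InFace A cF x

SaturationPoint : {n d : ℕ} → Config n d → ZVec d → Set
SaturationPoint {n} {d} A a =
  InQ A a × ((b : ZVec d) → InQsat A b → InQ A (λ j → a j ℤ.+ b j))

AlmostSaturated : {n d : ℕ} → Config n d → QVec d → Set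
AlmostSaturated {n} {d} A c =
  Σ (ZVec d) λ a → InFace A c (toℚ a) × SaturationPoint A a

{-# OPTIONS --safe #-}
module Submission where

open import Defs
open import Data.Nat using (ℕ)
open import Data.Product using (_,_)

AlmostSaturated-mono : {n d : ℕ} {A : Config n d} {cF cG : QVec d} →
  FaceSubset A cG cF → AlmostSaturated A cG → AlmostSaturated A cF
AlmostSaturated-mono G⊆F (a , a∈G , a-sat) = a , G⊆F (toℚ a) a∈G , a-sat

lemma2p1 : (n d : ℕ) (A : Config n d) →
    GeneratesLattice A → Pointed A → NonEmptyInterior A →
    (cF cG : QVec d) → Supporting A cF → Supporting A cG →
    FaceSubset A cG cF →
    AlmostSaturated A cG → AlmostSaturated A cF
lemma2p1 n d A _ _ _ cF cG _ _ = AlmostSaturated-mono {cF = cF} {cG = cG}
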